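{- Let $H$ be a false twin-free graph of (finite) diameter at least four. Then there exists a connected true twin-free graph $G$ of diameter two such that $G_{SR}\cong H$.
   Context: All graphs are finite, simple and undirected; $d_G$ is the distance in $G$, $N_G(v)$ and $N_G[v]$ the open and closed neighborhoods. Distinct vertices $u,v$ are true twins if $N_G[u]=N_G[v]$ and false twins if $N_G(u)=N_G(v)$; a graph is true (resp. false) twin-free if it has no true (resp. false) twins. A vertex $u$ is maximally distant from $v$ if $d_G(v,w)\le d_G(u,v)$ for every neighbor $w$ of $u$. Vertices $u,v$ are mutually maximally distant (MMD) if each is maximally distant from the other. The boundary $\partial(G)$ is the set of vertices maximally distant from some vertex of $G$. The strong resolving graph $G_{SR}$ has vertex set $\partial(G)$, two vertices being adjacent iff they are MMD in $G$. -}

module Defs where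

open import Data.Nat using (ℕ; zero; suc; _≤_)
open import Data.Fin using (Fin)
open import Data.Bool using (Bool; true; false)
open import Data.Product using (Σ; ∃; ∃-syntax; _×_; _,_)
open import Data.Sum using (_⊎_)
open import Relation.Nullary using (¬_)
open import Relation.Binary.PropositionalEquality using (_≡_; _≢_)
open import Function.Bundles using (_⇔_)
open import Function.Definitions using (Injective)

record Graph : Set where
  field
    n     : ℕ
    E     : Fin n → Fin n → Bool
    sym   : ∀ u v → E u v ≡ E v u
    irrefl : ∀ u → E u u ≡ false

open Graph public

V : Graph → Set
V G = Fin (n G)

Adj : (G : Graph) → V G → V G → Set
Adj G u v = E G u v ≡ true

data Walk (G : Graph) : V G → V G → ℕ → Set where
  nil  : ∀ {u} → Walk G u u 0
  cons : ∀ {u w v k} → Adj G u w → Walk G w v k → Walk G u v (suc k)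

Dist : (G : Graph) → V G → V G → ℕ → Set
Dist G u v k = Walk G u v k × (∀ j → Walk G u v j → k ≤ j)

Connected : Graph → Set
Connected G = ∀ (u v : V G) → ∃[ k ] Walk G u v k

HasDiameter : Graph → ℕ → Set
HasDiameter G d =
  Connected G ×
  (∀ u v k → Dist G u v k → k ≤ d) ×
  (∃[ u ] ∃[ v ] Dist G u v d)

DiameterAtLeast : Graph → ℕ → Set
DiameterAtLeast G d =
  Connected G × (∃[ u ] ∃[ v ] ∃[ k ] (Dist G u v k × d ≤ k))

InClosedNbhd : (G : Graph) → V G → V G → Set
InClosedNbhd G u w = (w ≡ u) ⊎ Adj G u w

TrueTwins : (G : Graph) → V G → V G → Set
TrueTwins G u v = u ≢ v × (∀ w → InClosedNbhd G u w ⇔ InClosedNbhd G v w)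

FalseTwins : (G : Graph) → V G → V G → Set
FalseTwins G u v = u ≢ v × (∀ w → Adj G u w ⇔ Adj G v w)

TrueTwinFree : Graph → Set
TrueTwinFree G = ∀ u v → ¬ TrueTwins G u v

FalseTwinFree : Graph → Set
FalseTwinFree G = ∀ u v → ¬ FalseTwins G u v

MaxDistFrom : (G : Graph) → V G → V G → Set
MaxDistFrom G u v =
  ∀ w → Adj G u w → ∀ a b → Dist G v w a → Dist G u v b → a ≤ b

MMD : (G : Graph) → V G → V G → Set
MMD G u v = MaxDistFrom G u v × MaxDistFrom G v u

InBoundary : (G : Graph) → V G → Set
InBoundary G u = ∃[ v ] MaxDistFrom G u v

-- G_SR ≅ H : an injection f : V(H) → V(G) whose image is exactly ∂(G)
-- and such that a ~_H b iff f a, f b are MMD in G.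
SRIsoTo : Graph → Graph → Set
SRIsoTo G H =
  Σ (V H → V G) λ f →
    Injective _≡_ _≡_ f ×
    (∀ a → InBoundary G (f a)) ×
    (∀ x → InBoundary G x → ∃[ a ] f a ≡ x) ×
    (∀ a b → Adj H a b ⇔ MMD G (f a) (f b))

-- The witness is the complement G of H. A pair at distance at least four in H forces, for
-- every vertex or edge of H, a vertex outside both closed neighbourhoods; hence G has diameter
-- two. In a graph of diameter two, distinct non-adjacent vertices are always mutually maximally
-- distant, while in any graph adjacent MMD vertices are true twins. Since N_G[u] is the complement of
-- N_H(u), true twins of G are exactly false twins of H, so G is true twin-free and its MMD
-- pairs are exactly the edges of H: the identity map is the isomorphism G_SR ≅ H.
module Submission where

open import Defs
open import Data.Bool using (true)
import Data.Bool.Properties as Bool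
open import Data.Fin using (_≟_)
open import Data.Fin.Properties using (any?)
open import Data.Nat using (ℕ; _+_; _≤_; z≤n; s≤s)
open import Data.Nat.Properties using (≤-trans; ≤-refl; ≤-antisym; +-mono-≤; ≤⇒≯; n≤1+n; <-irrefl)
open import Data.Product using (Σ; ∃-syntax; _×_; _,_; proj₁; proj₂)
open import Data.Sum using (_⊎_; inj₁; inj₂)
open import Function using (id; _∘_)
open import Function.Bundles using (_⇔_; mk⇔; Equivalence)
open import Relation.Binary.Definitions using (Decidable)
open import Relation.Binary.PropositionalEquality
  using (_≡_; _≢_; refl; trans; subst; ≢-sym) renaming (sym to ≡-sym)
open import Relation.Nullary using (¬_; Dec; yes; no; does; ¬?; _×-dec_; _⊎-dec_; contradiction)
open import Relation.Nullary.Decidable using (dec-true; dec-false; does-⇔; decidable-stable)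

does-true⇒ : ∀ {A : Set} (a? : Dec A) → does a? ≡ true → A
does-true⇒ (yes a) _ = a

adj? : (K : Graph) → Decidable (Adj K)
adj? K u v = E K u v Bool.≟ true

closedNbhd? : (K : Graph) → Decidable (InClosedNbhd K)
closedNbhd? K u w = (w ≟ u) ⊎-dec adj? K u w

WalkAtMost : (K : Graph) → ℕ → V K → V K → Set
WalkAtMost K m u v = ∃[ j ] (j ≤ m × Walk K u v j)

module _ {K : Graph} where

  variable
    u v w : V K
    i j l m d : ℕ

  adj-sym : Adj K u v → Adj K v u
  adj-sym {u = u} {v = v} uv = trans (Graph.sym K v u) uv

  adj⇒≢ : Adj K u v → u ≢ v
  adj⇒≢ {u = u} uv refl with trans (≡-sym (Graph.irrefl K u)) uv
  ... | ()

  closedNbhd-sym : InClosedNbhd K u w → InClosedNbhd K w u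
  closedNbhd-sym (inj₁ refl) = inj₁ refl
  closedNbhd-sym (inj₂ uw)   = inj₂ (adj-sym uw)

  infixr 5 _++ʷ_ _++≤_

  _++ʷ_ : Walk K u v i → Walk K v w j → Walk K u w (i + j)
  nil       ++ʷ q = q
  cons uw p ++ʷ q = cons uw (p ++ʷ q)

  _++≤_ : WalkAtMost K l u v → WalkAtMost K m v w → WalkAtMost K (l + m) u w
  (i , i≤l , p) ++≤ (j , j≤m , q) = i + j , +-mono-≤ i≤l j≤m , p ++ʷ q

  weaken : l ≤ m → WalkAtMost K l u v → WalkAtMost K m u v
  weaken l≤m (j , j≤l , p) = j , ≤-trans j≤l l≤m , p

  closedNbhd⇒walk : InClosedNbhd K u w → WalkAtMost K 1 u w
  closedNbhd⇒walk (inj₁ refl) = 0 , z≤n , nil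
  closedNbhd⇒walk (inj₂ uw)   = 1 , ≤-refl , cons uw nil

  walk⇒1≤ : u ≢ v → Walk K u v j → 1 ≤ j
  walk⇒1≤ u≢v nil        = contradiction refl u≢v
  walk⇒1≤ u≢v (cons _ _) = s≤s z≤n

  walk⇒2≤ : u ≢ v → ¬ Adj K u v → Walk K u v j → 2 ≤ j
  walk⇒2≤ u≢v _   nil                 = contradiction refl u≢v
  walk⇒2≤ u≢v ¬uv (cons uv nil)       = contradiction uv ¬uv
  walk⇒2≤ u≢v ¬uv (cons _ (cons _ _)) = s≤s (s≤s z≤n)

  dist≤ : Dist K u v d → WalkAtMost K m u v → d ≤ m
  dist≤ (_ , minimal) (j , j≤m , p) = ≤-trans (minimal j p) j≤m

  dist-adj : Adj K u v → Dist K u v 1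
  dist-adj uv = cons uv nil , λ _ → walk⇒1≤ (adj⇒≢ uv)

  dist-nonadj : u ≢ v → ¬ Adj K u v → WalkAtMost K 2 u v → Dist K u v 2
  dist-nonadj {u = u} {v = v} u≢v ¬uv (j , j≤2 , p) =
    subst (Walk K u v) (≤-antisym j≤2 (walk⇒2≤ u≢v ¬uv p)) p , λ _ → walk⇒2≤ u≢v ¬uv

  walk⇒neighbour : u ≢ v → Walk K u v j → ∃[ w ] Adj K u w
  walk⇒neighbour u≢v nil         = contradiction refl u≢v
  walk⇒neighbour _   (cons uw _) = _ , uw

  hasNeighbour : Connected K → u ≢ v → ∀ w → ∃[ w′ ] Adj K w w′
  hasNeighbour {u = u} {v = v} conn u≢v w with w ≟ v
  ... | yes refl = walk⇒neighbour (≢-sym u≢v) (proj₂ (conn w u))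
  ... | no w≢v   = walk⇒neighbour w≢v (proj₂ (conn w v))

  maxDistFrom-diameter2 : (∀ u v → WalkAtMost K 2 u v) → u ≢ v → ¬ Adj K u v → MaxDistFrom K u v
  maxDistFrom-diameter2 {v = v} diam u≢v ¬uv w _ _ _ dist-vw dist-uv =
    ≤-trans (dist≤ dist-vw (diam v w)) (walk⇒2≤ u≢v ¬uv (proj₁ dist-uv))

  ¬maxDistFrom-self : Adj K u w → ¬ MaxDistFrom K u u
  ¬maxDistFrom-self {w = w} uw md = contradiction (md w uw 1 0 (dist-adj uw) (nil , λ _ _ → z≤n)) λ ()

  maxDistFrom-adj⇒closedNbhd⊆ : Adj K u v → MaxDistFrom K u v →
                                 InClosedNbhd K u w → InClosedNbhd K v w
  maxDistFrom-adj⇒closedNbhd⊆ uv _ (inj₁ refl) = inj₂ (adj-sym uv)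
  maxDistFrom-adj⇒closedNbhd⊆ {v = v} {w = w} uv md (inj₂ uw) with closedNbhd? K v w
  ... | yes vw = vw
  ... | no ¬vw = contradiction (md w uw 2 1 (dist-nonadj v≢w (¬vw ∘ inj₂) walk-vuw) (dist-adj uv))
                              (<-irrefl refl)
    where
    v≢w : v ≢ w
    v≢w = ¬vw ∘ inj₁ ∘ ≡-sym
    walk-vuw : WalkAtMost K 2 v w
    walk-vuw = 2 , ≤-refl , cons (adj-sym uv) (cons uw nil)

  mmd-adj⇒trueTwins : Adj K u v → MMD K u v → TrueTwins K u v
  mmd-adj⇒trueTwins uv (u-from-v , v-from-u) =
    adj⇒≢ uv , λ _ → mk⇔ (maxDistFrom-adj⇒closedNbhd⊆ uv u-from-v)
                         (maxDistFrom-adj⇒closedNbhd⊆ (adj-sym uv) v-from-u)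

NonEdge : (H : Graph) → V H → V H → Set
NonEdge H u v = u ≢ v × ¬ Adj H u v

nonEdge? : (H : Graph) → Decidable (NonEdge H)
nonEdge? H u v = ¬? (u ≟ v) ×-dec ¬? (adj? H u v)

nonEdge-sym : ∀ {H u v} → NonEdge H u v → NonEdge H v u
nonEdge-sym {H} (u≢v , ¬uv) = ≢-sym u≢v , ¬uv ∘ adj-sym {K = H}

complement : Graph → Graph
complement H = record
  { n      = n H
  ; E      = λ u v → does (nonEdge? H u v)
  ; sym    = λ u v → does-⇔ (mk⇔ (nonEdge-sym {H}) (nonEdge-sym {H})) (nonEdge? H u v) (nonEdge? H v u)
  ; irrefl = λ u → dec-false (nonEdge? H u u) (λ (u≢u , _) → u≢u refl)
  }

module _ {H : Graph} where

  complement-adj⇔ : ∀ {u v} → Adj (complement H) u v ⇔ NonEdge H u v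
  complement-adj⇔ {u} {v} = mk⇔ (does-true⇒ (nonEdge? H u v)) (dec-true (nonEdge? H u v))

  complement-closedNbhd⇔ : ∀ {u w} → InClosedNbhd (complement H) u w ⇔ (¬ Adj H u w)
  complement-closedNbhd⇔ {u} {w} = mk⇔ to from
    where
    to : InClosedNbhd (complement H) u w → ¬ Adj H u w
    to (inj₁ refl) uu = adj⇒≢ {K = H} uu refl
    to (inj₂ uw)      = proj₂ (Equivalence.to complement-adj⇔ uw)
    from : ¬ Adj H u w → InClosedNbhd (complement H) u w
    from ¬uw with w ≟ u
    ... | yes w≡u = inj₁ w≡u
    ... | no w≢u  = inj₂ (Equivalence.from complement-adj⇔ (≢-sym w≢u , ¬uw))

  ¬closedNbhd⇒complement-adj : ∀ {u w} → ¬ InClosedNbhd H u w → Adj (complement H) u w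
  ¬closedNbhd⇒complement-adj ¬uw = Equivalence.from complement-adj⇔ (≢-sym (¬uw ∘ inj₁) , ¬uw ∘ inj₂)

  adj⇒¬complement-adj : ∀ {u v} → Adj H u v → ¬ Adj (complement H) u v
  adj⇒¬complement-adj uv g = proj₂ (Equivalence.to complement-adj⇔ g) uv

  complement-trueTwins⇒falseTwins : ∀ {u v} → TrueTwins (complement H) u v → FalseTwins H u v
  complement-trueTwins⇒falseTwins (u≢v , same) =
    u≢v , λ w → mk⇔ (transfer (Equivalence.from (same w))) (transfer (Equivalence.to (same w)))
    where
    transfer : ∀ {a b w} → (InClosedNbhd (complement H) b w → InClosedNbhd (complement H) a w) →
               Adj H a w → Adj H b w
    transfer {b = b} {w} b⊆a aw = decidable-stable (adj? H b w) λ ¬bw →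
      Equivalence.to complement-closedNbhd⇔ (b⊆a (Equivalence.from complement-closedNbhd⇔ ¬bw)) aw

  complement-trueTwinFree : FalseTwinFree H → TrueTwinFree (complement H)
  complement-trueTwinFree ftf u v = ftf u v ∘ complement-trueTwins⇒falseTwins

  module _ {x y : V H} (far : ∀ {j} → Walk H x y j → 4 ≤ j) where

    x≢y : x ≢ y
    x≢y refl = contradiction (far nil) λ ()

    noShortWalk : ¬ WalkAtMost H 3 x y
    noShortWalk (_ , j≤3 , p) = ≤⇒≯ j≤3 (far p)

    outsideClosedNbhds : ∀ {a b} → InClosedNbhd H a b →
                         ∃[ w ] (¬ InClosedNbhd H a w × ¬ InClosedNbhd H b w)
    outsideClosedNbhds {a} {b} ab with any? (λ w → ¬? (closedNbhd? H a w) ×-dec ¬? (closedNbhd? H b w))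
    ... | yes found = found
    ... | no none = contradiction x→y noShortWalk
      where
      covered : ∀ w → InClosedNbhd H a w ⊎ InClosedNbhd H b w
      covered w with closedNbhd? H a w | closedNbhd? H b w
      ... | yes aw | _      = inj₁ aw
      ... | no _   | yes bw = inj₂ bw
      ... | no ¬aw | no ¬bw = contradiction (w , ¬aw , ¬bw) none
      towards : ∀ {c w} → InClosedNbhd H c w → WalkAtMost H 1 w c
      towards = closedNbhd⇒walk ∘ closedNbhd-sym {K = H}
      x→y : WalkAtMost H 3 x y
      x→y with covered x | covered y
      ... | inj₁ ax | inj₁ ay = weaken (n≤1+n 2) (towards ax ++≤ closedNbhd⇒walk ay)
      ... | inj₁ ax | inj₂ by = towards ax ++≤ closedNbhd⇒walk ab ++≤ closedNbhd⇒walk by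
      ... | inj₂ bx | inj₁ ay = towards bx ++≤ towards ab ++≤ closedNbhd⇒walk ay
      ... | inj₂ bx | inj₂ by = weaken (n≤1+n 2) (towards bx ++≤ closedNbhd⇒walk by)

    complement-walk≤2 : ∀ u v → WalkAtMost (complement H) 2 u v
    complement-walk≤2 u v with u ≟ v | adj? H u v
    ... | yes refl | _      = 0 , z≤n , nil
    ... | no u≢v   | no ¬uv = 1 , s≤s z≤n , cons (Equivalence.from complement-adj⇔ (u≢v , ¬uv)) nil
    ... | no _     | yes uv with outsideClosedNbhds (inj₂ uv)
    ...   | w , ¬uw , ¬vw =
      2 , ≤-refl , cons (¬closedNbhd⇒complement-adj ¬uw)
                        (cons (adj-sym {K = complement H} (¬closedNbhd⇒complement-adj ¬vw)) nil)

    adj⇒complement-mmd : ∀ {a b} → Adj H a b → MMD (complement H) a b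
    adj⇒complement-mmd ab =
      maxDistFrom-diameter2 complement-walk≤2 (adj⇒≢ {K = H} ab) (adj⇒¬complement-adj ab) ,
      maxDistFrom-diameter2 complement-walk≤2 (adj⇒≢ {K = H} ba) (adj⇒¬complement-adj ba)
      where ba = adj-sym {K = H} ab

    complement-mmd⇒adj : FalseTwinFree H → ∀ {a b} → MMD (complement H) a b → Adj H a b
    complement-mmd⇒adj ftf {a} {b} mmd with adj? H a b | a ≟ b
    ... | yes ab | _        = ab
    ... | no _   | yes refl with outsideClosedNbhds (inj₁ (refl {x = a}))
    ...   | _ , ¬aw , _ = contradiction (proj₁ mmd) (¬maxDistFrom-self (¬closedNbhd⇒complement-adj ¬aw))
    complement-mmd⇒adj ftf {a} {b} mmd | no ¬ab | no a≢b =
      contradiction (mmd-adj⇒trueTwins (Equivalence.from complement-adj⇔ (a≢b , ¬ab)) mmd)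
                    (complement-trueTwinFree ftf a b)

    complement-connected : Connected (complement H)
    complement-connected u v = let (j , _ , p) = complement-walk≤2 u v in j , p

    module _ (conn : Connected H) where

      complement-hasDiameter2 : HasDiameter (complement H) 2
      complement-hasDiameter2 =
        complement-connected ,
        (λ u v _ d → dist≤ d (complement-walk≤2 u v)) ,
        x , x′ , dist-nonadj (adj⇒≢ {K = H} xx′) (adj⇒¬complement-adj xx′) (complement-walk≤2 x x′)
        where
        x′ = proj₁ (hasNeighbour conn x≢y x)
        xx′ = proj₂ (hasNeighbour conn x≢y x)

      complement-SRIsoTo : FalseTwinFree H → SRIsoTo (complement H) H
      complement-SRIsoTo ftf =
        id , id ,
        (λ a → let (b , ab) = hasNeighbour conn x≢y a in b , proj₁ (adj⇒complement-mmd ab)) ,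
        (λ a _ → a , refl) ,
        λ a b → mk⇔ adj⇒complement-mmd (complement-mmd⇒adj ftf)

corollary20 : (H : Graph) → FalseTwinFree H → DiameterAtLeast H 4 →
    Σ Graph (λ G → Connected G × TrueTwinFree G × HasDiameter G 2 × SRIsoTo G H)
corollary20 H ftf (conn , x , y , k , (_ , minimal) , 4≤k) =
  complement H ,
  complement-connected far ,
  complement-trueTwinFree {H} ftf ,
  complement-hasDiameter2 far conn ,
  complement-SRIsoTo far conn ftf
  where
  far : ∀ {j} → Walk H x y j → 4 ≤ j
  far p = ≤-trans 4≤k (minimal _ p)
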